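{- Let $(S_1,\circ)$ be a partial semigroup and $S_2$ a set. If $(Q,\le,\circ)$ is a quantale (respectively a distributive quantale), then so is $(Q^{S_1\times S_2},\le,\circ)$. If $S_1$ is a partial monoid and $Q$ is unital, then $Q^{S_1\times S_2}$ is unital with unit $\mathbb{1}_\circ$; if $S_1$ and $Q$ are commutative, then $Q^{S_1\times S_2}$ is commutative.
   Context: A partial semigroup has an associative partial operation (undefined products denoted $\bot\notin S_1$); a partial monoid additionally has a unit $1_\circ$. A quantale is a complete lattice with an associative multiplication distributing over arbitrary suprema on both sides; distributive if binary meets distribute over arbitrary joins and binary joins over arbitrary meets. On $Q^{S_1\times S_2}$ (functions written curried, $F\,x\,y$): order, suprema and infima are pointwise, and $(F\circ G)\,x\,y=\sum_{x=x_1\circ x_2}F\,x_1\,y\circ G\,x_2\,y$, the supremum over $x_1,x_2\in S_1$ with $x_1\circ x_2$ defined and equal to $x$. The unit is $\mathbb{1}_\circ\,x\,y=1_\circ$ if $x=1_\circ$ and $0$ otherwise (where $1_\circ$ also denotes the unit of $Q$). -}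

module Defs where

open import Level using (0ℓ)
open import Data.Bool using (Bool; if_then_else_)
open import Data.Product using (Σ; _×_; _,_)
open import Data.Maybe using (Maybe; just; _>>=_)
open import Relation.Binary using (Rel; IsPartialOrder)
open import Relation.Binary.PropositionalEquality using (_≡_)
open import Algebra.Core using (Op₂)
open import Algebra.Definitions using (Congruent₂; Associative; Commutative)

-- A partial operation is S → S → Maybe S (nothing = undefined, ⊥).
-- Associativity is Kleene equality: (x∘y)∘z defined iff x∘(y∘z) defined,
-- and then they are equal.

record IsPartialSemigroup (S : Set) (_∘_ : S → S → Maybe S) : Set where
  field
    assoc : ∀ x y z →
      ((x ∘ y) >>= λ w → w ∘ z) ≡ ((y ∘ z) >>= λ w → x ∘ w)

record IsPartialMonoid (S : Set) (_∘_ : S → S → Maybe S) (e : S) : Set where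
  field
    isPartialSemigroup : IsPartialSemigroup S _∘_
    identityˡ : ∀ x → (e ∘ x) ≡ just x
    identityʳ : ∀ x → (x ∘ e) ≡ just x

IsCommutativePartial : (S : Set) → (S → S → Maybe S) → Set
IsCommutativePartial S _∘_ = ∀ x y → (x ∘ y) ≡ (y ∘ x)

Sup : Set → Set₁
Sup Q = {I : Set} → (I → Q) → Q

record IsCompleteLattice (Q : Set) (_≈_ _≤_ : Rel Q 0ℓ) (⋁ ⋀ : Sup Q) : Set₁ where
  field
    isPartialOrder : IsPartialOrder _≈_ _≤_
    ⋁-upper    : ∀ {I : Set} (f : I → Q) (i : I) → f i ≤ ⋁ f
    ⋁-least    : ∀ {I : Set} (f : I → Q) (z : Q) → (∀ i → f i ≤ z) → ⋁ f ≤ z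
    ⋀-lower    : ∀ {I : Set} (f : I → Q) (i : I) → ⋀ f ≤ f i
    ⋀-greatest : ∀ {I : Set} (f : I → Q) (z : Q) → (∀ i → z ≤ f i) → z ≤ ⋀ f

join : {Q : Set} → Sup Q → Q → Q → Q
join ⋁ x y = ⋁ {Bool} (λ b → if b then x else y)

meet : {Q : Set} → Sup Q → Q → Q → Q
meet ⋀ x y = ⋀ {Bool} (λ b → if b then x else y)

record IsQuantale (Q : Set) (_≈_ _≤_ : Rel Q 0ℓ) (⋁ ⋀ : Sup Q) (_·_ : Op₂ Q) : Set₁ where
  field
    isCompleteLattice : IsCompleteLattice Q _≈_ _≤_ ⋁ ⋀
    ·-cong   : Congruent₂ _≈_ _·_
    ·-assoc  : Associative _≈_ _·_
    distribˡ : ∀ (a : Q) {I : Set} (f : I → Q) → (a · ⋁ f) ≈ ⋁ (λ i → a · f i)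
    distribʳ : ∀ (a : Q) {I : Set} (f : I → Q) → (⋁ f · a) ≈ ⋁ (λ i → f i · a)

record IsDistributiveQuantale (Q : Set) (_≈_ _≤_ : Rel Q 0ℓ) (⋁ ⋀ : Sup Q) (_·_ : Op₂ Q) : Set₁ where
  field
    isQuantale : IsQuantale Q _≈_ _≤_ ⋁ ⋀ _·_
    ∧-distrib-⋁ : ∀ (x : Q) {I : Set} (f : I → Q) →
                  meet ⋀ x (⋁ f) ≈ ⋁ (λ i → meet ⋀ x (f i))
    ∨-distrib-⋀ : ∀ (x : Q) {I : Set} (f : I → Q) →
                  join ⋁ x (⋀ f) ≈ ⋀ (λ i → join ⋁ x (f i))

record IsUnitalQuantale (Q : Set) (_≈_ _≤_ : Rel Q 0ℓ) (⋁ ⋀ : Sup Q) (_·_ : Op₂ Q) (𝟏 : Q) : Set₁ where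
  field
    isQuantale : IsQuantale Q _≈_ _≤_ ⋁ ⋀ _·_
    identityˡ  : ∀ x → (𝟏 · x) ≈ x
    identityʳ  : ∀ x → (x · 𝟏) ≈ x

record IsCommutativeQuantale (Q : Set) (_≈_ _≤_ : Rel Q 0ℓ) (⋁ ⋀ : Sup Q) (_·_ : Op₂ Q) : Set₁ where
  field
    isQuantale : IsQuantale Q _≈_ _≤_ ⋁ ⋀ _·_
    ·-comm     : Commutative _≈_ _·_

-- The function space Q^{S₁×S₂} (curried: S₁ → S₂ → Q) with pointwise
-- order/equality/sups/infs and convolution.

Fun : Set → Set → Set → Set
Fun S₁ S₂ Q = S₁ → S₂ → Q

module _ {S₁ S₂ Q : Set} where

  pw≈ : Rel Q 0ℓ → Rel (Fun S₁ S₂ Q) 0ℓ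
  pw≈ _≈_ F G = ∀ x y → F x y ≈ G x y

  pw≤ : Rel Q 0ℓ → Rel (Fun S₁ S₂ Q) 0ℓ
  pw≤ _≤_ F G = ∀ x y → F x y ≤ G x y

  pw⋁ : Sup Q → Sup (Fun S₁ S₂ Q)
  pw⋁ ⋁ Fs x y = ⋁ (λ i → Fs i x y)

  pw⋀ : Sup Q → Sup (Fun S₁ S₂ Q)
  pw⋀ ⋀ Fs x y = ⋀ (λ i → Fs i x y)

  conv : (S₁ → S₁ → Maybe S₁) → Sup Q → Op₂ Q → Op₂ (Fun S₁ S₂ Q)
  conv _∘_ ⋁ _·_ F G x y =
    ⋁ {Σ (S₁ × S₁) (λ { (x₁ , x₂) → (x₁ ∘ x₂) ≡ just x })}
      (λ { ((x₁ , x₂) , _) → F x₁ y · G x₂ y })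

  -- 𝟙 x y = 1 if x = e, 0 otherwise; written constructively as the sup
  -- of the constant 1 family indexed by the proposition x ≡ e
  -- (= 1 if x ≡ e, = ⋁ ∅ = 0 otherwise).
  unitF : S₁ → Sup Q → Q → Fun S₁ S₂ Q
  unitF e ⋁ 𝟏 x y = ⋁ {x ≡ e} (λ _ → 𝟏)

-- Order, equality, sups and infs on Fun S₁ S₂ Q are pointwise, so the
-- complete-lattice part (and distributivity of the lattice) is inherited
-- from Q coordinatewise.  Everything about the convolution
--   (F ⋆ G) x y = ⋁_{x₁ ∘ x₂ = x} F x₁ y · G x₂ y
-- reduces to manipulating sups over index types:
--   * congruence and distributivity over ⋁ follow from the same laws in Q
--     and the interchange of two sups;
--   * associativity: after distributing, both sides are double sups over
--     the two bracketings of a factorisation x = x₁ ∘ x₂ ∘ x₃; Kleene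
--     associativity of ∘ maps one bracketing to the other, and · is
--     associative;
--   * the unit 𝟙 = unitF e ⋁ 𝟏 picks out the factorisations x = e ∘ x
--     (resp. x ∘ e), which are the only ones contributing;
--   * commutativity swaps the two factors of each factorisation.
module Submission where

open import Defs
open import Level using (0ℓ)
open import Data.Product using (_×_; Σ; _,_; proj₁; proj₂)
open import Data.Maybe using (Maybe; just; nothing; _>>=_)
open import Data.Maybe.Properties using (just-injective)
open import Data.Bool using (true; false; if_then_else_)
open import Relation.Binary using (Rel; IsPartialOrder; Poset)
open import Relation.Binary.PropositionalEquality using (_≡_; refl; sym; trans; cong; module ≡-Reasoning)
import Relation.Binary.Reasoning.PartialOrder as PosetReasoning
open import Algebra.Core using (Op₂)

module CompleteLatticeFacts {Q : Set} {_≈_ _≤_ : Rel Q 0ℓ} {⋁ ⋀ : Sup Q}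
  (isCL : IsCompleteLattice Q _≈_ _≤_ ⋁ ⋀) where
  open IsCompleteLattice isCL public
  open IsPartialOrder isPartialOrder public
    using (antisym; reflexive; module Eq) renaming (trans to ≤-trans)

  poset : Poset 0ℓ 0ℓ 0ℓ
  poset = record { isPartialOrder = isPartialOrder }

  ⋁-mono : ∀ {I J : Set} {f : I → Q} {g : J → Q} →
    (∀ i → Σ J (λ j → f i ≤ g j)) → ⋁ f ≤ ⋁ g
  ⋁-mono {f = f} {g} dom =
    ⋁-least f (⋁ g) (λ i → ≤-trans (proj₂ (dom i)) (⋁-upper g (proj₁ (dom i))))

  ⋀-mono : ∀ {I J : Set} {f : I → Q} {g : J → Q} →
    (∀ j → Σ I (λ i → f i ≤ g j)) → ⋀ f ≤ ⋀ g
  ⋀-mono {f = f} {g} dom =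
    ⋀-greatest g (⋀ f) (λ j → ≤-trans (⋀-lower f (proj₁ (dom j))) (proj₂ (dom j)))

  ⋁-cong : ∀ {I : Set} {f g : I → Q} → (∀ i → f i ≈ g i) → ⋁ f ≈ ⋁ g
  ⋁-cong f≈g = antisym (⋁-mono (λ i → i , reflexive (f≈g i)))
                       (⋁-mono (λ i → i , reflexive (Eq.sym (f≈g i))))

  ⋀-cong : ∀ {I : Set} {f g : I → Q} → (∀ i → f i ≈ g i) → ⋀ f ≈ ⋀ g
  ⋀-cong f≈g = antisym (⋀-mono (λ i → i , reflexive (f≈g i)))
                       (⋀-mono (λ i → i , reflexive (Eq.sym (f≈g i))))

  ⋁⋁-mono : ∀ {I I′ : Set} {J : I → Set} {J′ : I′ → Set}
    {f : ∀ i → J i → Q} {g : ∀ i′ → J′ i′ → Q} →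
    (∀ i j → Σ I′ (λ i′ → Σ (J′ i′) (λ j′ → f i j ≤ g i′ j′))) →
    ⋁ (λ i → ⋁ (f i)) ≤ ⋁ (λ i′ → ⋁ (g i′))
  ⋁⋁-mono {f = f} {g} dom = ⋁-least _ _ λ i → ⋁-least (f i) _ λ j →
    let (i′ , j′ , fij≤g) = dom i j
    in ≤-trans fij≤g (≤-trans (⋁-upper (g i′) j′) (⋁-upper _ i′))

  ⋁-swap : ∀ {I J : Set} (f : I → J → Q) →
    ⋁ (λ i → ⋁ (λ j → f i j)) ≈ ⋁ (λ j → ⋁ (λ i → f i j))
  ⋁-swap f = antisym (⋁⋁-mono (λ i j → j , i , reflexive Eq.refl))
                     (⋁⋁-mono (λ j i → i , j , reflexive Eq.refl))

  pointwise : {S₁ S₂ : Set} →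
    IsCompleteLattice (Fun S₁ S₂ Q) (pw≈ _≈_) (pw≤ _≤_) (pw⋁ ⋁) (pw⋀ ⋀)
  pointwise = record
    { isPartialOrder = record
      { isPreorder = record
        { isEquivalence = record
          { refl  = λ x y → Eq.refl
          ; sym   = λ F≈G x y → Eq.sym (F≈G x y)
          ; trans = λ F≈G G≈H x y → Eq.trans (F≈G x y) (G≈H x y) }
        ; reflexive = λ F≈G x y → reflexive (F≈G x y)
        ; trans     = λ F≤G G≤H x y → ≤-trans (F≤G x y) (G≤H x y) }
      ; antisym = λ F≤G G≤F x y → antisym (F≤G x y) (G≤F x y) }
    ; ⋁-upper    = λ Fs i x y → ⋁-upper (λ j → Fs j x y) i
    ; ⋁-least    = λ Fs Z ub x y → ⋁-least (λ j → Fs j x y) (Z x y) (λ i → ub i x y)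
    ; ⋀-lower    = λ Fs i x y → ⋀-lower (λ j → Fs j x y) i
    ; ⋀-greatest = λ Fs Z lb x y → ⋀-greatest (λ j → Fs j x y) (Z x y) (λ i → lb i x y)
    }

  module _ {S₁ S₂ : Set} (F G : Fun S₁ S₂ Q) (x : S₁) (y : S₂) where

    private
      if-pointwise : ∀ b → (if b then F else G) x y ≈ (if b then F x y else G x y)
      if-pointwise true  = Eq.refl
      if-pointwise false = Eq.refl

    meet-pointwise : meet (pw⋀ ⋀) F G x y ≈ meet ⋀ (F x y) (G x y)
    meet-pointwise = ⋀-cong if-pointwise

    join-pointwise : join (pw⋁ ⋁) F G x y ≈ join ⋁ (F x y) (G x y)
    join-pointwise = ⋁-cong if-pointwise

bind-just : {A : Set} (m : Maybe A) (g : A → Maybe A) {x : A} →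
  (m >>= g) ≡ just x → Σ A (λ a → (m ≡ just a) × (g a ≡ just x))
bind-just (just a) g eq = a , refl , eq
bind-just nothing  g ()

module PartialSemigroupFacts {S : Set} {_∘_ : S → S → Maybe S}
  (isPS : IsPartialSemigroup S _∘_) where
  open IsPartialSemigroup isPS
  open ≡-Reasoning

  reassocʳ : ∀ {a b c d x} → (c ∘ d) ≡ just a → (a ∘ b) ≡ just x →
    Σ S (λ a′ → ((d ∘ b) ≡ just a′) × ((c ∘ a′) ≡ just x))
  reassocʳ {a} {b} {c} {d} {x} cd≡a ab≡x = bind-just (d ∘ b) (c ∘_) (begin
    ((d ∘ b) >>= (c ∘_))  ≡⟨ sym (assoc c d b) ⟩
    ((c ∘ d) >>= (_∘ b))  ≡⟨ cong (_>>= (_∘ b)) cd≡a ⟩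
    a ∘ b                 ≡⟨ ab≡x ⟩
    just x                ∎)

  reassocˡ : ∀ {a′ b c d x} → (d ∘ b) ≡ just a′ → (c ∘ a′) ≡ just x →
    Σ S (λ a → ((c ∘ d) ≡ just a) × ((a ∘ b) ≡ just x))
  reassocˡ {a′} {b} {c} {d} {x} db≡a′ ca′≡x = bind-just (c ∘ d) (_∘ b) (begin
    ((c ∘ d) >>= (_∘ b))  ≡⟨ assoc c d b ⟩
    ((d ∘ b) >>= (c ∘_))  ≡⟨ cong (_>>= (c ∘_)) db≡a′ ⟩
    c ∘ a′                ≡⟨ ca′≡x ⟩
    just x                ∎)

module Convolution {S₁ S₂ Q : Set} (_∘_ : S₁ → S₁ → Maybe S₁)
  {_≈_ _≤_ : Rel Q 0ℓ} {⋁ ⋀ : Sup Q} {_·_ : Op₂ Q}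
  (isPS : IsPartialSemigroup S₁ _∘_) (isQ : IsQuantale Q _≈_ _≤_ ⋁ ⋀ _·_) where
  open IsQuantale isQ
  open CompleteLatticeFacts isCompleteLattice
  open PartialSemigroupFacts isPS
  open PosetReasoning poset

  _⋆_ : Op₂ (Fun S₁ S₂ Q)
  _⋆_ = conv _∘_ ⋁ _·_

  Split : S₁ → Set
  Split x = Σ (S₁ × S₁) (λ { (x₁ , x₂) → (x₁ ∘ x₂) ≡ just x })

  ⋆-cong : ∀ {F F′ G G′ : Fun S₁ S₂ Q} →
    pw≈ _≈_ F F′ → pw≈ _≈_ G G′ → pw≈ _≈_ (F ⋆ G) (F′ ⋆ G′)
  ⋆-cong F≈F′ G≈G′ x y = ⋁-cong λ { ((a , b) , _) → ·-cong (F≈F′ a y) (G≈G′ b y) }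

  -- Distribute · in each summand, then interchange the two sups.
  ⋆-distribˡ : ∀ (H : Fun S₁ S₂ Q) {I : Set} (Fs : I → Fun S₁ S₂ Q) →
    pw≈ _≈_ (H ⋆ pw⋁ ⋁ Fs) (pw⋁ ⋁ (λ i → H ⋆ Fs i))
  ⋆-distribˡ H Fs x y =
    Eq.trans (⋁-cong λ { ((a , b) , _) → distribˡ (H a y) (λ i → Fs i b y) }) (⋁-swap _)

  ⋆-distribʳ : ∀ (H : Fun S₁ S₂ Q) {I : Set} (Fs : I → Fun S₁ S₂ Q) →
    pw≈ _≈_ (pw⋁ ⋁ Fs ⋆ H) (pw⋁ ⋁ (λ i → Fs i ⋆ H))
  ⋆-distribʳ H Fs x y =
    Eq.trans (⋁-cong λ { ((a , b) , _) → distribʳ (H b y) (λ i → Fs i a y) }) (⋁-swap _)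

  -- Both bracketings of a threefold convolution equal a double sup over
  -- factorisations x = x₁ ∘ x₂ ∘ x₃; re-bracketing matches their terms.
  ⋆-assoc : ∀ (F G H : Fun S₁ S₂ Q) → pw≈ _≈_ ((F ⋆ G) ⋆ H) (F ⋆ (G ⋆ H))
  ⋆-assoc F G H x y = begin-equality
    ((F ⋆ G) ⋆ H) x y  ≈⟨ ⋁-cong (λ { ((_ , b) , _) → distribʳ (H b y) _ }) ⟩
    left-bracketed     ≈⟨ antisym left≤right right≤left ⟩
    right-bracketed    ≈⟨ Eq.sym (⋁-cong (λ { ((c , _) , _) → distribˡ (F c y) _ })) ⟩
    (F ⋆ (G ⋆ H)) x y  ∎
    where
    left-bracketed : Q
    left-bracketed = ⋁ {Split x} (λ { ((a , b) , _) → ⋁ {Split a} (λ { ((c , d) , _) →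
      (F c y · G d y) · H b y }) })

    right-bracketed : Q
    right-bracketed = ⋁ {Split x} (λ { ((c , a′) , _) → ⋁ {Split a′} (λ { ((d , b) , _) →
      F c y · (G d y · H b y) }) })

    left≤right : left-bracketed ≤ right-bracketed
    left≤right = ⋁⋁-mono λ { ((a , b) , ab≡x) ((c , d) , cd≡a) →
      let (a′ , db≡a′ , ca′≡x) = reassocʳ cd≡a ab≡x
      in ((c , a′) , ca′≡x) , ((d , b) , db≡a′) , reflexive (·-assoc (F c y) (G d y) (H b y)) }

    right≤left : right-bracketed ≤ left-bracketed
    right≤left = ⋁⋁-mono λ { ((c , a′) , ca′≡x) ((d , b) , db≡a′) →
      let (a , cd≡a , ab≡x) = reassocˡ db≡a′ ca′≡x
      in ((a , b) , ab≡x) , ((c , d) , cd≡a) , reflexive (Eq.sym (·-assoc (F c y) (G d y) (H b y))) }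

  isQuantale⋆ : IsQuantale (Fun S₁ S₂ Q) (pw≈ _≈_) (pw≤ _≤_) (pw⋁ ⋁) (pw⋀ ⋀) _⋆_
  isQuantale⋆ = record
    { isCompleteLattice = pointwise
    ; ·-cong   = ⋆-cong
    ; ·-assoc  = ⋆-assoc
    ; distribˡ = ⋆-distribˡ
    ; distribʳ = ⋆-distribʳ
    }

module PointwiseDistributivity {S₁ S₂ Q : Set} {_≈_ _≤_ : Rel Q 0ℓ} {⋁ ⋀ : Sup Q}
  {_·_ : Op₂ Q} (isDQ : IsDistributiveQuantale Q _≈_ _≤_ ⋁ ⋀ _·_) where
  open IsDistributiveQuantale isDQ
  open CompleteLatticeFacts (IsQuantale.isCompleteLattice isQuantale)

  pw-∧-distrib-⋁ : ∀ (X : Fun S₁ S₂ Q) {I : Set} (Fs : I → Fun S₁ S₂ Q) →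
    pw≈ _≈_ (meet (pw⋀ ⋀) X (pw⋁ ⋁ Fs)) (pw⋁ ⋁ (λ i → meet (pw⋀ ⋀) X (Fs i)))
  pw-∧-distrib-⋁ X Fs x y = begin-equality
    meet (pw⋀ ⋀) X (pw⋁ ⋁ Fs) x y         ≈⟨ meet-pointwise X (pw⋁ ⋁ Fs) x y ⟩
    meet ⋀ (X x y) (⋁ (λ i → Fs i x y))   ≈⟨ ∧-distrib-⋁ (X x y) (λ i → Fs i x y) ⟩
    ⋁ (λ i → meet ⋀ (X x y) (Fs i x y))   ≈⟨ ⋁-cong (λ i → Eq.sym (meet-pointwise X (Fs i) x y)) ⟩
    pw⋁ ⋁ (λ i → meet (pw⋀ ⋀) X (Fs i)) x y ∎
    where open PosetReasoning poset

  pw-∨-distrib-⋀ : ∀ (X : Fun S₁ S₂ Q) {I : Set} (Fs : I → Fun S₁ S₂ Q) →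
    pw≈ _≈_ (join (pw⋁ ⋁) X (pw⋀ ⋀ Fs)) (pw⋀ ⋀ (λ i → join (pw⋁ ⋁) X (Fs i)))
  pw-∨-distrib-⋀ X Fs x y = begin-equality
    join (pw⋁ ⋁) X (pw⋀ ⋀ Fs) x y         ≈⟨ join-pointwise X (pw⋀ ⋀ Fs) x y ⟩
    join ⋁ (X x y) (⋀ (λ i → Fs i x y))   ≈⟨ ∨-distrib-⋀ (X x y) (λ i → Fs i x y) ⟩
    ⋀ (λ i → join ⋁ (X x y) (Fs i x y))   ≈⟨ ⋀-cong (λ i → Eq.sym (join-pointwise X (Fs i) x y)) ⟩
    pw⋀ ⋀ (λ i → join (pw⋁ ⋁) X (Fs i)) x y ∎
    where open PosetReasoning poset

module ConvolutionUnit {S₁ S₂ Q : Set} (_∘_ : S₁ → S₁ → Maybe S₁)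
  {_≈_ _≤_ : Rel Q 0ℓ} {⋁ ⋀ : Sup Q} {_·_ : Op₂ Q} (e : S₁) (𝟏 : Q)
  (isPM : IsPartialMonoid S₁ _∘_ e) (isUQ : IsUnitalQuantale Q _≈_ _≤_ ⋁ ⋀ _·_ 𝟏) where
  open IsUnitalQuantale isUQ renaming (identityˡ to 𝟏-identityˡ; identityʳ to 𝟏-identityʳ)
  open IsQuantale isQuantale
  open CompleteLatticeFacts isCompleteLattice
  open IsPartialMonoid isPM renaming (identityˡ to e-identityˡ; identityʳ to e-identityʳ)
  open Convolution {S₂ = S₂} _∘_ isPartialSemigroup isQuantale using (_⋆_)
  open PosetReasoning poset

  𝟙 : Fun S₁ S₂ Q
  𝟙 = unitF e ⋁ 𝟏

  e-cancelˡ : ∀ {b x} → (e ∘ b) ≡ just x → b ≡ x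
  e-cancelˡ {b} eb≡x = just-injective (trans (sym (e-identityˡ b)) eb≡x)

  e-cancelʳ : ∀ {a x} → (a ∘ e) ≡ just x → a ≡ x
  e-cancelʳ {a} ae≡x = just-injective (trans (sym (e-identityʳ a)) ae≡x)

  -- A summand 𝟙 a y · F b y of (𝟙 ⋆ F) x y vanishes unless a = e, in which
  -- case b = x and the summand is F x y.
  𝟙⋆-summand≤ : ∀ (F : Fun S₁ S₂ Q) {a b x} y → (a ∘ b) ≡ just x → (𝟙 a y · F b y) ≤ F x y
  𝟙⋆-summand≤ F {a} {b} {x} y ab≡x = begin
    (𝟙 a y · F b y)               ≈⟨ distribʳ (F b y) _ ⟩
    ⋁ {a ≡ e} (λ _ → 𝟏 · F b y)   ≤⟨ ⋁-least _ _ at-unit ⟩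
    F x y                         ∎
    where
    at-unit : a ≡ e → (𝟏 · F b y) ≤ F x y
    at-unit refl = begin
      (𝟏 · F b y)  ≈⟨ 𝟏-identityˡ (F b y) ⟩
      F b y        ≡⟨ cong (λ b′ → F b′ y) (e-cancelˡ ab≡x) ⟩
      F x y        ∎

  ⋆𝟙-summand≤ : ∀ (F : Fun S₁ S₂ Q) {a b x} y → (a ∘ b) ≡ just x → (F a y · 𝟙 b y) ≤ F x y
  ⋆𝟙-summand≤ F {a} {b} {x} y ab≡x = begin
    (F a y · 𝟙 b y)               ≈⟨ distribˡ (F a y) _ ⟩
    ⋁ {b ≡ e} (λ _ → F a y · 𝟏)   ≤⟨ ⋁-least _ _ at-unit ⟩
    F x y                         ∎
    where
    at-unit : b ≡ e → (F a y · 𝟏) ≤ F x y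
    at-unit refl = begin
      (F a y · 𝟏)  ≈⟨ 𝟏-identityʳ (F a y) ⟩
      F a y        ≡⟨ cong (λ a′ → F a′ y) (e-cancelʳ ab≡x) ⟩
      F x y        ∎

  ⋆-identityˡ : ∀ (F : Fun S₁ S₂ Q) → pw≈ _≈_ (𝟙 ⋆ F) F
  ⋆-identityˡ F x y = antisym
    (⋁-least _ _ λ { ((_ , _) , ab≡x) → 𝟙⋆-summand≤ F y ab≡x })
    (begin
      F x y                         ≈⟨ Eq.sym (𝟏-identityˡ (F x y)) ⟩
      (𝟏 · F x y)                   ≤⟨ ⋁-upper _ refl ⟩
      ⋁ {e ≡ e} (λ _ → 𝟏 · F x y)   ≈⟨ Eq.sym (distribʳ (F x y) _) ⟩
      (𝟙 e y · F x y)               ≤⟨ ⋁-upper _ ((e , x) , e-identityˡ x) ⟩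
      (𝟙 ⋆ F) x y                   ∎)

  ⋆-identityʳ : ∀ (F : Fun S₁ S₂ Q) → pw≈ _≈_ (F ⋆ 𝟙) F
  ⋆-identityʳ F x y = antisym
    (⋁-least _ _ λ { ((_ , _) , ab≡x) → ⋆𝟙-summand≤ F y ab≡x })
    (begin
      F x y                         ≈⟨ Eq.sym (𝟏-identityʳ (F x y)) ⟩
      (F x y · 𝟏)                   ≤⟨ ⋁-upper _ refl ⟩
      ⋁ {e ≡ e} (λ _ → F x y · 𝟏)   ≈⟨ Eq.sym (distribˡ (F x y) _) ⟩
      (F x y · 𝟙 e y)               ≤⟨ ⋁-upper _ ((x , e) , e-identityʳ x) ⟩
      (F ⋆ 𝟙) x y                   ∎)

module ConvolutionCommutative {S₁ S₂ Q : Set} (_∘_ : S₁ → S₁ → Maybe S₁)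
  {_≈_ _≤_ : Rel Q 0ℓ} {⋁ ⋀ : Sup Q} {_·_ : Op₂ Q}
  (∘-comm : IsCommutativePartial S₁ _∘_) (isCQ : IsCommutativeQuantale Q _≈_ _≤_ ⋁ ⋀ _·_) where
  open IsCommutativeQuantale isCQ
  open IsQuantale isQuantale
  open CompleteLatticeFacts isCompleteLattice

  _⋆_ : Op₂ (Fun S₁ S₂ Q)
  _⋆_ = conv _∘_ ⋁ _·_

  ⋆-comm≤ : ∀ (F G : Fun S₁ S₂ Q) → pw≤ _≤_ (F ⋆ G) (G ⋆ F)
  ⋆-comm≤ F G x y = ⋁-mono λ { ((a , b) , ab≡x) →
    ((b , a) , trans (∘-comm b a) ab≡x) , reflexive (·-comm (F a y) (G b y)) }

  ⋆-comm : ∀ (F G : Fun S₁ S₂ Q) → pw≈ _≈_ (F ⋆ G) (G ⋆ F)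
  ⋆-comm F G x y = antisym (⋆-comm≤ F G x y) (⋆-comm≤ G F x y)

proposition10p3 : {S₁ S₂ Q : Set} (_∘_ : S₁ → S₁ → Maybe S₁)
    (_≈_ _≤_ : Rel Q 0ℓ) (⋁ ⋀ : Sup Q) (_·_ : Op₂ Q) →
    IsPartialSemigroup S₁ _∘_ →
    (IsQuantale Q _≈_ _≤_ ⋁ ⋀ _·_ →
      IsQuantale (Fun S₁ S₂ Q) (pw≈ _≈_) (pw≤ _≤_) (pw⋁ ⋁) (pw⋀ ⋀) (conv _∘_ ⋁ _·_))
    × (IsDistributiveQuantale Q _≈_ _≤_ ⋁ ⋀ _·_ →
      IsDistributiveQuantale (Fun S₁ S₂ Q) (pw≈ _≈_) (pw≤ _≤_) (pw⋁ ⋁) (pw⋀ ⋀) (conv _∘_ ⋁ _·_))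
    × ((e : S₁) (𝟏 : Q) → IsPartialMonoid S₁ _∘_ e →
      IsUnitalQuantale Q _≈_ _≤_ ⋁ ⋀ _·_ 𝟏 →
      IsUnitalQuantale (Fun S₁ S₂ Q) (pw≈ _≈_) (pw≤ _≤_) (pw⋁ ⋁) (pw⋀ ⋀) (conv _∘_ ⋁ _·_) (unitF e ⋁ 𝟏))
    × (IsCommutativePartial S₁ _∘_ →
      IsCommutativeQuantale Q _≈_ _≤_ ⋁ ⋀ _·_ →
      IsCommutativeQuantale (Fun S₁ S₂ Q) (pw≈ _≈_) (pw≤ _≤_) (pw⋁ ⋁) (pw⋀ ⋀) (conv _∘_ ⋁ _·_))
proposition10p3 {S₂ = S₂} _∘_ _≈_ _≤_ ⋁ ⋀ _·_ isPS =
    quantale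
  , (λ isDQ → record
      { isQuantale  = quantale (IsDistributiveQuantale.isQuantale isDQ)
      ; ∧-distrib-⋁ = PointwiseDistributivity.pw-∧-distrib-⋁ isDQ
      ; ∨-distrib-⋀ = PointwiseDistributivity.pw-∨-distrib-⋀ isDQ
      })
  , (λ e 𝟏 isPM isUQ → record
      { isQuantale = quantale (IsUnitalQuantale.isQuantale isUQ)
      ; identityˡ  = ConvolutionUnit.⋆-identityˡ {S₂ = S₂} _∘_ e 𝟏 isPM isUQ
      ; identityʳ  = ConvolutionUnit.⋆-identityʳ {S₂ = S₂} _∘_ e 𝟏 isPM isUQ
      })
  , (λ ∘-comm isCQ → record
      { isQuantale = quantale (IsCommutativeQuantale.isQuantale isCQ)
      ; ·-comm     = ConvolutionCommutative.⋆-comm {S₂ = S₂} _∘_ ∘-comm isCQ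
      })
  where
  quantale : IsQuantale _ _≈_ _≤_ ⋁ ⋀ _·_ →
    IsQuantale (Fun _ S₂ _) (pw≈ _≈_) (pw≤ _≤_) (pw⋁ ⋁) (pw⋀ ⋀) (conv _∘_ ⋁ _·_)
  quantale = Convolution.isQuantale⋆ _∘_ isPS
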